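{- Let $I_0$ be an instance, $\Sigma_{\mathrm{UID}}$ a transitively closed set of unary inclusion dependencies, and $n\in\mathbb{N}$. For any two elements $a$ and $b$ of $\mathrm{chase}(I_0,\Sigma_{\mathrm{UID}})$ introduced at positions $R^p$ and $S^q$ respectively, with $R^p\sim_{\mathrm{ID}} S^q$, if $a$ and $b$ are both $n$-reversible then $a\simeq_n b$ in $\mathrm{chase}(I_0,\Sigma_{\mathrm{UID}})$.
   Context: A UID $R^p\subseteq S^q$ ($R^p\neq S^q$) states that every element at position $R^p$ also occurs at position $S^q$. $\Sigma_{\mathrm{UID}}$ is transitively closed if whenever $R^p\subseteq S^q$ and $S^q\subseteq T^r$ are in it and $R^p\neq T^r$, then $R^p\subseteq T^r$ is in it. A UID $\tau:R^p\subseteq S^q$ is reversible if its reverse $S^q\subseteq R^p$ is also in $\Sigma_{\mathrm{UID}}$. $R^p\sim_{\mathrm{ID}}S^q$ iff $R^p=S^q$ or both $R^p\subseteq S^q$ and $S^q\subseteq R^p$ are in $\Sigma_{\mathrm{UID}}$. The chase $\mathrm{chase}(I_0,\Sigma_{\mathrm{UID}})$: an element $a$ at position $R^p$ with $a$ not at $S^q$, for $\tau:R^p\subseteq S^q\in\Sigma_{\mathrm{UID}}$, makes $\tau$ applicable; applying it to the fact $F'$ containing $a$ at $R^p$ adds a new fact $S(\mathbf b)$ with $b_q=a$ (the exported element, at the exported position) and fresh nulls at all other positions; these nulls are said to be introduced at their positions in this fact, $F'$ is the parent of the new fact, and $\tau$ is the last UID of each such introduced element. Chase rounds apply all applicable steps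 simultaneously with distinct fresh nulls, except that in the first round only one new fact is kept per pair (exported element, exported position); the chase is the union over all rounds. The last $n$ UIDs of an introduced element $c$ are $\tau_1,\dots,\tau_n$ where $\tau_1$ is the last UID of $c$ and $\tau_{i+1}$ is the last UID of the exported element of the fact in which the element with last UID $\tau_i$ was introduced (defined only if these elements are themselves introduced, not in $I_0$). An element is $n$-reversible if its last $n$ UIDs are defined and all reversible. For instances $I,I'$ and $a\in\mathrm{dom}(I)$, $b\in\mathrm{dom}(I')$: $(I,a)\le_0(I',b)$ always; $(I,a)\le_m(I',b)$ iff for every fact $R(\mathbf a)$ of $I$ and position $p$ with $a_p=a$ there is a fact $R(\mathbf b)$ of $I'$ with $b_p=b$ and $(I,a_j)\le_{m-1}(I',b_j)$ for all $j$. In one instance $I$, $a\simeq_m b$ iff $(I,a)\le_m(I,b)$ and $(I,b)\le_m(I,a)$. -}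

module Defs where

open import Data.Nat using (ℕ; zero; suc; _<?_; _≟_)
open import Data.Fin using (Fin; toℕ; fromℕ<)
open import Data.List using (List; length; lookup)
open import Data.List.Membership.Propositional using (_∈_)
open import Data.Product using (Σ; Σ-syntax; ∃; ∃-syntax; _×_; _,_; proj₁; proj₂)
open import Data.Sum using (_⊎_)
open import Data.Empty using (⊥)
open import Data.Unit using (⊤)
open import Relation.Nullary using (¬_; yes; no)
open import Relation.Binary.PropositionalEquality using (_≡_; _≢_)

record Signature : Set where
  field
    nRel  : ℕ
    arity : Fin nRel → ℕ

module _ (σ : Signature) where
  open Signature σ

  Rel : Set
  Rel = Fin nRel

  Pos : Set
  Pos = Σ Rel (λ R → Fin (arity R))

  -- a UID R^p ⊆ S^q is represented by the pair (R^p , S^q)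
  UID : Set
  UID = Pos × Pos

  BaseFact : Set → Set
  BaseFact Const = Σ Rel (λ R → Fin (arity R) → Const)

  -- Generic instance: an index set of facts, each with a relation name and a
  -- tuple (given as ℕ-indexed; only the positions toℕ p, p : Fin (arity R),
  -- are meaningful).
  record Instance (D : Set) : Set₁ where
    field
      Idx : Set
      rel : Idx → Rel
      tup : Idx → ℕ → D

  Le : {D : Set} → ℕ → Instance D → Instance D → D → D → Set
  Le zero I I' a b = ⊤
  Le {D} (suc m) I I' a b =
    (i : Instance.Idx I) (p : Fin (arity (Instance.rel I i))) →
    Instance.tup I i (toℕ p) ≡ a →
    Σ[ i' ∈ Instance.Idx I' ]
      (Instance.rel I' i' ≡ Instance.rel I i) ×
      (Instance.tup I' i' (toℕ p) ≡ b) ×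
      ((j : Fin (arity (Instance.rel I i))) →
        Le m I I' (Instance.tup I i (toℕ j)) (Instance.tup I' i' (toℕ j)))

  Sim : {D : Set} → ℕ → Instance D → D → D → Set
  Sim m I a b = Le m I I a b × Le m I I b a

  NonTrivialUIDs : List UID → Set
  NonTrivialUIDs Σu = ∀ {P Q} → (P , Q) ∈ Σu → P ≢ Q

  TransClosed : List UID → Set
  TransClosed Σu = ∀ {P Q T} → (P , Q) ∈ Σu → (Q , T) ∈ Σu → P ≢ T → (P , T) ∈ Σu

  Reversible : List UID → UID → Set
  Reversible Σu (P , Q) = (Q , P) ∈ Σu

  SimID : List UID → Pos → Pos → Set
  SimID Σu P Q = P ≡ Q ⊎ ((P , Q) ∈ Σu × (Q , P) ∈ Σu)

-- A chase fact is either a fact of I0 (by index) or the fact  gen F τ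
-- created by applying the UID τ : R^p ⊆ S^q to the fact F (exporting the
-- element of F at position p). The null introduced at position j of the
-- fact G is  null G j.

module _ (σ : Signature) (Const : Set) (I0 : List (BaseFact σ Const)) where
  open Signature σ

  data FId : Set where
    base : Fin (length I0) → FId
    gen  : FId → UID σ → FId

  data Elem : Set where
    const : Const → Elem
    null  : FId → ℕ → Elem

  relOf : FId → Rel σ
  relOf (base i) = proj₁ (lookup I0 i)
  relOf (gen F τ) = proj₁ (proj₂ τ)

  tuple : FId → ℕ → Elem
  tuple (base i) n with n <? arity (proj₁ (lookup I0 i))
  ... | yes h = const (proj₂ (lookup I0 i) (fromℕ< h))
  ... | no _  = null (base i) n
  tuple (gen F τ) n with n ≟ toℕ (proj₂ (proj₂ τ))
  ... | yes _ = tuple F (toℕ (proj₂ (proj₁ τ)))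
  ... | no _  = null (gen F τ) n

  exported : FId → UID σ → Elem
  exported F τ = tuple F (toℕ (proj₂ (proj₁ τ)))

  IsBase : FId → Set
  IsBase (base _) = ⊤
  IsBase (gen _ _) = ⊥

  OccAt : (FId → Set) → Elem → Pos σ → Set
  OccAt S a (R , q) = Σ[ G ∈ FId ] S G × relOf G ≡ R × tuple G (toℕ q) ≡ a

  module _ (Σu : List (UID σ)) where

    Applicable : (FId → Set) → FId → UID σ → Set
    Applicable S F τ =
      S F × τ ∈ Σu × relOf F ≡ proj₁ (proj₁ τ) × ¬ OccAt S (exported F τ) (proj₂ τ)

    Trigger0 : FId → UID σ → Set
    Trigger0 = Applicable IsBase

    -- A choice, for the first round, of which triggers are kept: exactly one
    -- per pair (exported element, exported position).
    ValidChoice : (FId → UID σ → Set) → Set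
    ValidChoice Keep =
      (∀ F τ → Trigger0 F τ →
         Σ[ F' ∈ FId ] Σ[ τ' ∈ UID σ ]
           Trigger0 F' τ' × Keep F' τ' ×
           exported F' τ' ≡ exported F τ × proj₂ τ' ≡ proj₂ τ) ×
      (∀ F τ F' τ' → Trigger0 F τ → Trigger0 F' τ' → Keep F τ → Keep F' τ' →
         exported F τ ≡ exported F' τ' → proj₂ τ ≡ proj₂ τ' →
         (F ≡ F') × (τ ≡ τ'))

    module _ (Keep : FId → UID σ → Set) where

      mutual
        Chase≤ : ℕ → FId → Set
        Chase≤ zero F = IsBase F
        Chase≤ (suc k) F = Chase≤ k F ⊎ New k F

        -- facts created in round k+1
        New : ℕ → FId → Set
        New k (base _) = ⊥
        New k (gen F τ) = Applicable (Chase≤ k) F τ × (k ≡ 0 → Keep F τ)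

      InChase : FId → Set
      InChase F = ∃[ k ] Chase≤ k F

      ChaseInst : Instance σ Elem
      ChaseInst = record
        { Idx = Σ FId InChase
        ; rel = λ F → relOf (proj₁ F)
        ; tup = λ F → tuple (proj₁ F)
        }

      IntroducedAt : Elem → Pos σ → Set
      IntroducedAt a (R , p) =
        Σ[ F ∈ FId ] Σ[ τ ∈ UID σ ]
          InChase (gen F τ) × proj₁ (proj₂ τ) ≡ R ×
          toℕ p ≢ toℕ (proj₂ (proj₂ τ)) × a ≡ null (gen F τ) (toℕ p)

      -- n-reversible: the last n UIDs are defined and all reversible.
      -- The last UID of  null (gen F τ) j  is τ; the next one is the last UID
      -- of the exported element of  gen F τ.
      NReversible : ℕ → Elem → Set
      NReversible zero a = ⊤
      NReversible (suc n) (const _) = ⊥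
      NReversible (suc n) (null (base _) _) = ⊥
      NReversible (suc n) (null (gen F τ) _) =
        Reversible σ Σu τ × NReversible n (exported F τ)

module Submission where

-- Both a and b are nulls; a ≼[n] b is shown by induction on n.
-- A fact of the chase holding the null a = null G p (introduced at P) is
-- either G itself or a child  gen G (P , Z)  that exported a to a position Z.
-- Since P ∼ Q, the null b = null G' q has a matching fact: G' when Z = Q,
-- and otherwise the child  gen G' (Q , Z),  which is in the chase because a
-- fresh null is exported by every applicable UID.  The matched facts are
-- compared position by position in two ways:
--   * when one side is G or G' (or a child along a reversible UID), every
--     element of both facts is m-reversible and introduced at a position ∼ its
--     own ("placed"), so the induction hypothesis applies to each pair;
--   * when both sides are children created at the same position Z, all other
--     elements are fresh nulls, and a separate lemma shows that fresh nulls of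
--     facts agreeing on their exported element are related ("siblings").

open import Defs
open import Data.Nat using (ℕ; zero; suc; _≟_; _<?_; _<_; _≤_; _≤′_; ≤′-refl; ≤′-step)
open import Data.Nat.Properties using (<⇒≤; m<n⇒m<1+n; m<1+n⇒m≤n; n<1+n; ≤⇒≤′)
open import Data.Fin using (Fin; toℕ)
open import Data.Fin.Properties using (toℕ-injective; toℕ<n) renaming (_≟_ to _≟ᶠ_)
open import Data.List using (List; lookup)
open import Data.List.Membership.Propositional using (_∈_)
open import Data.Product using (Σ; Σ-syntax; _×_; _,_; proj₁; proj₂)
open import Data.Product.Properties using (≡-dec)
open import Data.Sum using (_⊎_; inj₁; inj₂)
open import Data.Empty using (⊥-elim)
open import Data.Unit using (⊤; tt)
open import Function using (_∘_)
open import Relation.Nullary using (¬_; Dec; yes; no)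
open import Relation.Binary.PropositionalEquality using (_≡_; _≢_; refl; sym; trans; cong; subst; subst₂)

module ChaseSimilarity
  (σ : Signature) (Const : Set) (I0 : List (BaseFact σ Const))
  (Σu : List (UID σ)) (nontrivial : NonTrivialUIDs σ Σu) (closed : TransClosed σ Σu)
  (Keep : FId σ Const I0 → UID σ → Set) where

  open Signature σ using (arity)

  Fact : Set
  Fact = FId σ Const I0

  Element : Set
  Element = Elem σ Const I0

  Position : Set
  Position = Pos σ

  Dependency : Set
  Dependency = UID σ

  rel : Fact → Rel σ
  rel = relOf σ Const I0

  tup : Fact → ℕ → Element
  tup = tuple σ Const I0

  export : Fact → Dependency → Element
  export = exported σ Const I0

  src tgt : Dependency → ℕ
  src τ = toℕ (proj₂ (proj₁ τ))
  tgt τ = toℕ (proj₂ (proj₂ τ))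

  ChaseAt : ℕ → Fact → Set
  ChaseAt = Chase≤ σ Const I0 Σu Keep

  NewAt : ℕ → Fact → Set
  NewAt = New σ Const I0 Σu Keep

  InC : Fact → Set
  InC = InChase σ Const I0 Σu Keep

  Occurs : (Fact → Set) → Element → Position → Set
  Occurs = OccAt σ Const I0

  Intro : Element → Position → Set
  Intro = IntroducedAt σ Const I0 Σu Keep

  NRev : ℕ → Element → Set
  NRev = NReversible σ Const I0 Σu Keep

  _∼_ : Position → Position → Set
  _∼_ = SimID σ Σu

  Chase : Instance σ Element
  Chase = ChaseInst σ Const I0 Σu Keep

  _≼[_]_ : Element → ℕ → Element → Set
  a ≼[ m ] b = Le σ m Chase Chase a b

  tup-cases : ∀ F τ l → (l ≡ tgt τ × tup (gen F τ) l ≡ export F τ)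
                      ⊎ (l ≢ tgt τ × tup (gen F τ) l ≡ null (gen F τ) l)
  tup-cases F τ l with l ≟ tgt τ
  ... | yes l≡t = inj₁ (l≡t , refl)
  ... | no l≢t = inj₂ (l≢t , refl)

  tup-target : ∀ F τ → tup (gen F τ) (tgt τ) ≡ export F τ
  tup-target F τ with tup-cases F τ (tgt τ)
  ... | inj₁ (_ , t≡x) = t≡x
  ... | inj₂ (t≢t , _) = ⊥-elim (t≢t refl)

  tup-fresh : ∀ F τ {l} → l ≢ tgt τ → tup (gen F τ) l ≡ null (gen F τ) l
  tup-fresh F τ {l} l≢t with tup-cases F τ l
  ... | inj₁ (l≡t , _) = ⊥-elim (l≢t l≡t)
  ... | inj₂ (_ , l≡null) = l≡null

  base-const : ∀ i {l G k} → l < arity (rel (base i)) → tup (base i) l ≢ null G k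
  base-const i {l} l<ar eq with l <? arity (proj₁ (lookup I0 i))
  base-const i l<ar () | yes _
  base-const i l<ar eq | no l≮ar = l≮ar l<ar

  base-export-const : ∀ i τ {G k} → rel (base i) ≡ proj₁ (proj₁ τ) → export (base i) τ ≢ null G k
  base-export-const i τ rel≡ =
    base-const i (subst (λ R → src τ < arity R) (sym rel≡) (toℕ<n (proj₂ (proj₁ τ))))

  pos-≡ : ∀ {P Q : Position} → proj₁ P ≡ proj₁ Q → toℕ (proj₂ P) ≡ toℕ (proj₂ Q) → P ≡ Q
  pos-≡ {R , i} {.R , j} refl i≡j = cong (R ,_) (toℕ-injective i≡j)

  _≟ₚ_ : (P Q : Position) → Dec (P ≡ Q)
  _≟ₚ_ = ≡-dec _≟ᶠ_ _≟ᶠ_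

  index-of : ∀ H (W : Position) → rel H ≡ proj₁ W →
             Σ[ p ∈ Fin (arity (rel H)) ] toℕ p ≡ toℕ (proj₂ W)
  index-of H (R , q) refl = q , refl

  ∼-sym : ∀ {P Q} → P ∼ Q → Q ∼ P
  ∼-sym (inj₁ refl) = inj₁ refl
  ∼-sym (inj₂ (PQ , QP)) = inj₂ (QP , PQ)

  ∼-trans : ∀ {P Q T} → P ∼ Q → Q ∼ T → P ∼ T
  ∼-trans {P} {_} {T} _ _ with P ≟ₚ T
  ... | yes P≡T = inj₁ P≡T
  ∼-trans (inj₁ refl) Q∼T | no _ = Q∼T
  ∼-trans (inj₂ PQ) (inj₁ refl) | no _ = inj₂ PQ
  ∼-trans (inj₂ (PQ , QP)) (inj₂ (QT , TQ)) | no P≢T =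
    inj₂ (closed PQ QT P≢T , closed TQ QP (P≢T ∘ sym))

  ∼-distinct : ∀ {P Q} → P ∼ Q → P ≢ Q → (P , Q) ∈ Σu × (Q , P) ∈ Σu
  ∼-distinct (inj₁ P≡Q) P≢Q = ⊥-elim (P≢Q P≡Q)
  ∼-distinct (inj₂ PQ) _ = PQ

  ∼-include : ∀ {P Q Z} → P ∼ Q → (P , Z) ∈ Σu → Q ≢ Z → (Q , Z) ∈ Σu
  ∼-include (inj₁ refl) PZ _ = PZ
  ∼-include (inj₂ (_ , QP)) PZ Q≢Z = closed QP PZ Q≢Z

  chase-mono′ : ∀ {j k F} → j ≤′ k → ChaseAt j F → ChaseAt k F
  chase-mono′ ≤′-refl c = c
  chase-mono′ (≤′-step j≤′k) c = inj₁ (chase-mono′ j≤′k c)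

  chase-mono : ∀ {j k F} → j ≤ k → ChaseAt j F → ChaseAt k F
  chase-mono = chase-mono′ ∘ ≤⇒≤′

  occurs-mono : ∀ {j k e} W → j ≤ k → Occurs (ChaseAt j) e W → Occurs (ChaseAt k) e W
  occurs-mono _ j≤k (G , c , rel≡ , tup≡) = G , chase-mono j≤k c , rel≡ , tup≡

  creation-round : ∀ k {F τ} → ChaseAt k (gen F τ) → Σ[ r ∈ ℕ ] r < k × NewAt r (gen F τ)
  creation-round (suc k) (inj₁ c) with creation-round k c
  ... | r , r<k , new = r , m<n⇒m<1+n r<k , new
  creation-round (suc k) (inj₂ new) = k , n<1+n k , new

  creation : ∀ {F τ} → InC (gen F τ) → Σ[ r ∈ ℕ ] NewAt r (gen F τ)
  creation (k , c) with creation-round k c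
  ... | r , _ , new = r , new

  parent-in-chase : ∀ {F τ} → InC (gen F τ) → InC F
  parent-in-chase c with creation c
  ... | r , (cF , _) , _ = r , cF

  uid-in-Σ : ∀ {F τ} → InC (gen F τ) → τ ∈ Σu
  uid-in-Σ c with creation c
  ... | _ , (_ , τ∈ , _) , _ = τ∈

  parent-rel : ∀ {F τ} → InC (gen F τ) → rel F ≡ proj₁ (proj₁ τ)
  parent-rel c with creation c
  ... | _ , (_ , _ , rel≡ , _) , _ = rel≡

  new-not-yet : ∀ {r F τ} → NewAt r (gen F τ) → ¬ ChaseAt r (gen F τ)
  new-not-yet {F = F} {τ} ((_ , _ , _ , fresh) , _) c = fresh (gen F τ , c , refl , tup-target F τ)

  -- A null exported into  gen G υ  is never exported again by a UID τ leaving
  -- the position where it landed: G was created in a round r' > 0, and in round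
  -- r' either the null already sat at τ's target in G, or the shortcut UID
  -- (source of υ) ⊆ (target of τ), which is in Σu by transitivity, put it
  -- there; either way τ was not applicable when it fired.
  no-reexport : ∀ G υ τ {H k} → InC (gen (gen G υ) τ) → src τ ≡ tgt υ → export G υ ≢ null H k
  no-reexport (base i) υ τ c _ = base-export-const i υ (parent-rel (parent-in-chase c))
  no-reexport (gen G₀ υ₀) υ τ c s≡t _ with creation c
  ... | r , (cGυ , τ∈ , relGυ , fresh) , _ with creation-round r cGυ
  ... | r' , r'<r , (cG , υ∈ , relG , _) , _ =
        fresh (subst (λ e → Occurs (ChaseAt r) e (proj₂ τ)) (sym re-exported) already-there)
    where
    G : Fact
    G = gen G₀ υ₀
    re-exported : export (gen G υ) τ ≡ export G υ
    re-exported = trans (cong (tup (gen G υ)) s≡t) (tup-target G υ)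
    already-there : Occurs (ChaseAt r) (export G υ) (proj₂ τ)
    already-there with proj₁ υ ≟ₚ proj₂ τ
    ... | yes υ₁≡τ₂ =
          G , chase-mono (<⇒≤ r'<r) cG , trans relG (cong proj₁ υ₁≡τ₂) ,
          cong (tup G ∘ toℕ ∘ proj₂) (sym υ₁≡τ₂)
    ... | no υ₁≢τ₂ = gen G ω , chase-mono r'<r (inj₂ shortcut-new) , refl , tup-target G ω
      where
      ω : Dependency
      ω = proj₁ υ , proj₂ τ
      ω∈ : ω ∈ Σu
      ω∈ = closed υ∈ (subst (λ X → (X , proj₂ τ) ∈ Σu) (sym (pos-≡ relGυ (sym s≡t))) τ∈) υ₁≢τ₂
      shortcut-new : NewAt r' (gen G ω)
      shortcut-new =
        (cG , ω∈ , relG ,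
         λ occ → fresh (subst (λ e → Occurs (ChaseAt r) e (proj₂ τ)) (sym re-exported)
                              (occurs-mono (proj₂ τ) (<⇒≤ r'<r) occ))) ,
        λ r'≡0 → ⊥-elim (subst (λ k → ChaseAt k G) r'≡0 cG)

  export-origin : ∀ F τ {G k} → InC (gen F τ) → export F τ ≡ null G k → F ≡ G × src τ ≡ k
  export-origin (base i) τ c x≡null = ⊥-elim (base-export-const i τ (parent-rel c) x≡null)
  export-origin (gen F τ') τ c x≡null with src τ ≟ tgt τ'
  ... | yes s≡t = ⊥-elim (no-reexport F τ' τ c s≡t x≡null)
  export-origin (gen F τ') τ c refl | no _ = refl , refl

  null-occurrence : ∀ H (p : Fin (arity (rel H))) {G k} → InC H → tup H (toℕ p) ≡ null G k →
    (H ≡ G × toℕ p ≡ k) ⊎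
    (Σ[ υ ∈ Dependency ] H ≡ gen G υ × υ ∈ Σu × rel G ≡ proj₁ (proj₁ υ) × src υ ≡ k × toℕ p ≡ tgt υ)
  null-occurrence (base i) p _ eq = ⊥-elim (base-const i (toℕ<n p) eq)
  null-occurrence (gen F τ) p c eq with toℕ p ≟ tgt τ
  ... | yes p≡t with export-origin F τ c eq
  ...   | refl , s≡k = inj₂ (τ , refl , uid-in-Σ c , parent-rel c , s≡k , p≡t)
  null-occurrence (gen F τ) p c refl | no _ = inj₁ (refl , refl)

  -- A null of a chase fact G at the source of a UID υ ∈ Σu is exported by υ:
  -- in the round after G's creation only G holds the null, and not at υ's target.
  child-in-chase : ∀ G υ → InC G → υ ∈ Σu → rel G ≡ proj₁ (proj₁ υ) →
                   tup G (src υ) ≡ null G (src υ) → proj₁ υ ≢ proj₂ υ → InC (gen G υ)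
  child-in-chase (base i) υ _ _ relG eq _ = ⊥-elim (base-export-const i υ relG eq)
  child-in-chase (gen F τ) υ (k , c) υ∈ relG eq υ-nontrivial with creation-round k c
  ... | r , _ , newG = suc (suc r) , inj₂ ((inj₂ newG , υ∈ , relG , fresh) , λ ())
    where
    fresh : ¬ Occurs (ChaseAt (suc r)) (export (gen F τ) υ) (proj₂ υ)
    fresh (H , cH , relH , tupH) with index-of H (proj₂ υ) relH
    ... | p , p≡ with null-occurrence H p (suc r , cH) (trans (cong (tup H) p≡) (trans tupH eq))
    ...   | inj₁ (refl , p≡src) = υ-nontrivial (pos-≡ (trans (sym relG) relH) (trans (sym p≡src) p≡))
    ...   | inj₂ (_ , refl , _) with creation-round (suc r) cH
    ...     | r' , r'<sr , (cG , _) , _ = new-not-yet newG (chase-mono (m<1+n⇒m≤n r'<sr) cG)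

  ≼-down : ∀ m {a b} → a ≼[ suc m ] b → a ≼[ m ] b
  ≼-down zero _ = tt
  ≼-down (suc m) a≼b H p eq with a≼b H p eq
  ... | H' , rel≡ , tup≡ , related = H' , rel≡ , tup≡ , λ j → ≼-down m (related j)

  Twin : ℕ → Fact → Fact → Set
  Twin m H H' = (j : Fin (arity (rel H))) → tup H (toℕ j) ≼[ m ] tup H' (toℕ j)

  twin-down : ∀ m {H H'} → Twin (suc m) H H' → Twin m H H'
  twin-down m twin j = ≼-down m (twin j)

  -- A chase fact matching H and holding b at index j: one step of ≼[m+1].
  Match : ℕ → (H : Fact) → Fin (arity (rel H)) → Element → Set
  Match m H j b = Σ[ H' ∈ Σ Fact InC ]
    rel (proj₁ H') ≡ rel H × tup (proj₁ H') (toℕ j) ≡ b × Twin m H (proj₁ H')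

  mutual
    -- Two facts created at the same position are m-twins once their exported
    -- elements are ≼[m]-related: all their other elements are fresh nulls.
    fresh-twin : ∀ m {G G' X Y Z} → InC (gen G (X , Z)) → InC (gen G' (Y , Z)) →
                 export G (X , Z) ≼[ m ] export G' (Y , Z) → Twin m (gen G (X , Z)) (gen G' (Y , Z))
    fresh-twin zero _ _ _ _ = tt
    fresh-twin (suc m) {G} {G'} {X} {Y} {Z} c c' x≼y j with tup-cases G (X , Z) (toℕ j)
    ... | inj₁ (j≡t , j↦x) = subst₂ _≼[ suc m ]_ (sym j↦x) (sym j↦x′) x≼y
      where
      j↦x′ : tup (gen G' (Y , Z)) (toℕ j) ≡ export G' (Y , Z)
      j↦x′ = trans (cong (tup (gen G' (Y , Z))) j≡t) (tup-target G' (Y , Z))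
    ... | inj₂ (j≢t , j↦null) =
          subst₂ _≼[ suc m ]_ (sym j↦null) (sym j↦null′)
                 (sibling m {gen G (X , Z)} {gen G' (Y , Z)} c c' refl
                          (fresh-twin m c c' (≼-down m x≼y)) (toℕ j) j↦null′)
      where
      j↦null′ : tup (gen G' (Y , Z)) (toℕ j) ≡ null (gen G' (Y , Z)) (toℕ j)
      j↦null′ = tup-fresh G' (Y , Z) j≢t

    -- A fact holding the first null is its own fact (matched
    -- by the twin) or a child exporting it (matched by the same child of the twin).
    sibling : ∀ m {G G'} → InC G → InC G' → rel G ≡ rel G' → Twin m G G' →
              ∀ l → tup G' l ≡ null G' l → null G l ≼[ suc m ] null G' l
    sibling m {G} {G'} c c' rel≡ twin l l↦null (H , cH) p eq with null-occurrence H p cH eq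
    ... | inj₁ (refl , p≡l) = (G' , c') , sym rel≡ , trans (cong (tup G') p≡l) l↦null , twin
    ... | inj₂ (υ , refl , υ∈ , relG , s≡l , p≡t) =
          (gen G' υ , cK) , refl , trans (cong (tup (gen G' υ)) p≡t) (trans (tup-target G' υ) out′↦null) ,
          fresh-twin m cH cK (subst₂ _≼[ m ]_ (sym out↦null) (sym out′↦null)
                                    (sibling-at m c c' rel≡ twin l l↦null))
      where
      out↦null : export G υ ≡ null G l
      out↦null = trans (sym (tup-target G υ)) (trans (cong (tup (gen G υ)) (sym p≡t)) eq)
      out′↦null : export G' υ ≡ null G' l
      out′↦null = trans (cong (tup G') s≡l) l↦null
      cK : InC (gen G' υ)
      cK = child-in-chase G' υ c' υ∈ (trans (sym rel≡) relG)
             (subst (λ i → tup G' i ≡ null G' i) (sym s≡l) l↦null) (nontrivial υ∈)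

    sibling-at : ∀ m {G G'} → InC G → InC G' → rel G ≡ rel G' → Twin m G G' →
                 ∀ l → tup G' l ≡ null G' l → null G l ≼[ m ] null G' l
    sibling-at zero _ _ _ _ _ _ = tt
    sibling-at (suc m) {G} {G'} c c' rel≡ twin = sibling m {G} {G'} c c' rel≡ (twin-down m {G} {G'} twin)

  nrev-down : ∀ m {e} → NRev (suc m) e → NRev m e
  nrev-down zero _ = tt
  nrev-down (suc m) {const _} ()
  nrev-down (suc m) {null (base _) _} ()
  nrev-down (suc m) {null (gen _ _) _} (rev , nr) = rev , nrev-down m nr

  nrev-null : ∀ m {e} → NRev (suc m) e → Σ[ F ∈ Fact ] Σ[ τ ∈ Dependency ] Σ[ k ∈ ℕ ] e ≡ null (gen F τ) k
  nrev-null m {const _} ()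
  nrev-null m {null (base _) _} ()
  nrev-null m {null (gen F τ) k} _ = F , τ , k , refl

  export-introduced : ∀ F τ {F₁ τ₁ k} → InC (gen F τ) → export F τ ≡ null (gen F₁ τ₁) k →
                      Intro (export F τ) (proj₁ τ)
  export-introduced F τ {F₁} {τ₁} c x≡null with export-origin F τ c x≡null
  ... | refl , s≡k =
        F₁ , τ₁ , parent-in-chase c , parent-rel c , s≢t ,
        trans x≡null (cong (null (gen F₁ τ₁)) (sym s≡k))
    where
    s≢t : src τ ≢ tgt τ₁
    s≢t s≡t = no-reexport F₁ τ₁ τ c s≡t
                (trans (sym (tup-target F₁ τ₁)) (trans (cong (tup (gen F₁ τ₁)) (sym s≡t)) x≡null))

  Anchored : ℕ → Element → Position → Set
  Anchored m e W = Σ[ P ∈ Position ] Intro e P × P ∼ W × NRev (suc m) e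

  Placed : ℕ → Fact → Set
  Placed zero _ = ⊤
  Placed (suc m) H = (W : Position) → proj₁ W ≡ rel H → Anchored m (tup H (toℕ (proj₂ W))) W

  -- A fact created by a reversible UID from an m-reversible exported element is
  -- placed: the exported element is introduced at the UID's source, which is ∼
  -- its target by reversibility, and the fresh nulls are introduced where they sit.
  placed-created : ∀ m F τ → InC (gen F τ) → Reversible σ Σu τ → NRev m (export F τ) → Placed m (gen F τ)
  placed-created zero _ _ _ _ _ = tt
  placed-created (suc m) F τ c rev nr W relW with tup-cases F τ (toℕ (proj₂ W))
  ... | inj₁ (w≡t , w↦x) =
        subst₂ (Anchored m) (sym w↦x) (pos-≡ (sym relW) (sym w≡t)) export-anchored
    where
    export-anchored : Anchored m (export F τ) (proj₂ τ)
    export-anchored with nrev-null m nr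
    ... | _ , _ , _ , x≡null = proj₁ τ , export-introduced F τ c x≡null , inj₂ (uid-in-Σ c , rev) , nr
  ... | inj₂ (w≢t , w↦null) =
        subst (λ e → Anchored m e W) (sym w↦null)
              (W , (F , τ , c , sym relW , w≢t , refl) , inj₁ refl , rev , nrev-down m nr)

  Claim : ℕ → Set
  Claim n = ∀ {a b P Q} → Intro a P → Intro b Q → P ∼ Q → NRev n a → NRev n b → a ≼[ n ] b

  twin-of-placed : ∀ m {H H'} → Claim m → rel H ≡ rel H' → Placed m H → Placed m H' → Twin m H H'
  twin-of-placed zero _ _ _ _ _ = tt
  twin-of-placed (suc m) {H} claim rel≡ placed placed′ j
    with placed (rel H , j) refl | placed′ (rel H , j) rel≡
  ... | _ , ia , P∼ , na | _ , ib , Q∼ , nb = claim ia ib (∼-trans P∼ (∼-sym Q∼)) na nb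

  module Step (m : ℕ) (claim : Claim m) {F F' : Fact} {τ τ' : Dependency} {P Q : Position}
    (c : InC (gen F τ)) (rτ : proj₁ (proj₂ τ) ≡ proj₁ P) (p≢t : toℕ (proj₂ P) ≢ tgt τ)
    (c' : InC (gen F' τ')) (rτ' : proj₁ (proj₂ τ') ≡ proj₁ Q) (q≢t : toℕ (proj₂ Q) ≢ tgt τ')
    (P∼Q : P ∼ Q) (rev : Reversible σ Σu τ) (na : NRev m (export F τ))
    (rev' : Reversible σ Σu τ') (nb : NRev m (export F' τ')) where

    G G' : Fact
    G = gen F τ
    G' = gen F' τ'

    a b : Element
    a = null G (toℕ (proj₂ P))
    b = null G' (toℕ (proj₂ Q))

    a-at-P : tup G (toℕ (proj₂ P)) ≡ a
    a-at-P = tup-fresh F τ p≢t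

    b-at-Q : tup G' (toℕ (proj₂ Q)) ≡ b
    b-at-Q = tup-fresh F' τ' q≢t

    a≼b : a ≼[ m ] b
    a≼b = claim (F , τ , c , rτ , p≢t , refl) (F' , τ' , c' , rτ' , q≢t , refl) P∼Q
                (nrev-down m (rev , na)) (nrev-down m (rev' , nb))

    placed-G : Placed m G
    placed-G = placed-created m F τ c rev na

    placed-G' : Placed m G'
    placed-G' = placed-created m F' τ' c' rev' nb

    child' : ∀ Z → (Q , Z) ∈ Σu → InC (gen G' (Q , Z))
    child' Z QZ = child-in-chase G' (Q , Z) c' QZ rτ' b-at-Q (nontrivial QZ)

    child'-holds-b : ∀ Z {l} → l ≡ toℕ (proj₂ Z) → tup (gen G' (Q , Z)) l ≡ b
    child'-holds-b Z l≡z = trans (cong (tup (gen G' (Q , Z))) l≡z) (trans (tup-target G' (Q , Z)) b-at-Q)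

    -- a in G, P = Q: matched by G'; both facts are placed.
    match-self : P ≡ Q → (j : Fin (arity (rel G))) → toℕ j ≡ toℕ (proj₂ P) → Match m G j b
    match-self P≡Q j j≡p =
      (G' , c') , trans rτ' (trans (cong proj₁ (sym P≡Q)) (sym rτ)) ,
      trans (cong (tup G') (trans j≡p (cong (toℕ ∘ proj₂) P≡Q))) b-at-Q ,
      twin-of-placed m claim (trans rτ (trans (cong proj₁ P≡Q) (sym rτ'))) placed-G placed-G'

    -- a in G, P ≠ Q: matched by the child of G' exporting b back to P, created
    -- by the reversible UID Q ⊆ P, hence placed.
    match-swap : P ≢ Q → (j : Fin (arity (rel G))) → toℕ j ≡ toℕ (proj₂ P) → Match m G j b
    match-swap P≢Q j j≡p =
      (gen G' (Q , P) , child' P QP) , sym rτ , child'-holds-b P j≡p ,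
      twin-of-placed m claim rτ placed-G
        (placed-created m G' (Q , P) (child' P QP) PQ (subst (NRev m) (sym b-at-Q) (nrev-down m (rev' , nb))))
      where
      PQ : (P , Q) ∈ Σu
      PQ = proj₁ (∼-distinct P∼Q P≢Q)
      QP : (Q , P) ∈ Σu
      QP = proj₂ (∼-distinct P∼Q P≢Q)

    -- a exported from P to Q, with Q ⊆ P: matched by G'; the child of G is
    -- created by a reversible UID, hence placed.
    match-back : (Q , P) ∈ Σu → InC (gen G (P , Q)) →
                 (j : Fin (arity (proj₁ Q))) → toℕ j ≡ toℕ (proj₂ Q) → Match m (gen G (P , Q)) j b
    match-back QP cH j j≡q =
      (G' , c') , rτ' , trans (cong (tup G') j≡q) b-at-Q ,
      twin-of-placed m claim (sym rτ')
        (placed-created m G (P , Q) cH QP (subst (NRev m) (sym a-at-P) (nrev-down m (rev , na)))) placed-G'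

    -- a exported from P to Z ≠ Q: matched by the child of G' exporting b from Q
    -- to Z; the two children are twins since a ≼[m] b.
    match-child : ∀ Z → (Q , Z) ∈ Σu → InC (gen G (P , Z)) →
                  (j : Fin (arity (proj₁ Z))) → toℕ j ≡ toℕ (proj₂ Z) → Match m (gen G (P , Z)) j b
    match-child Z QZ cH j j≡z =
      (gen G' (Q , Z) , child' Z QZ) , refl , child'-holds-b Z j≡z ,
      fresh-twin m cH (child' Z QZ) (subst₂ _≼[ m ]_ (sym a-at-P) (sym b-at-Q) a≼b)

    respond-child : ∀ Z → (P , Z) ∈ Σu → InC (gen G (P , Z)) →
                    (j : Fin (arity (proj₁ Z))) → toℕ j ≡ toℕ (proj₂ Z) → Match m (gen G (P , Z)) j b
    respond-child Z PZ cH j j≡z with Z ≟ₚ Q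
    ... | yes refl = match-back (proj₂ (∼-distinct P∼Q (nontrivial PZ))) cH j j≡z
    ... | no Z≢Q = match-child Z (∼-include P∼Q PZ (Z≢Q ∘ sym)) cH j j≡z

    respond : a ≼[ suc m ] b
    respond (H , cH) j eq with null-occurrence H j cH eq
    ... | inj₁ (refl , j≡p) with P ≟ₚ Q
    ...   | yes P≡Q = match-self P≡Q j j≡p
    ...   | no P≢Q = match-swap P≢Q j j≡p
    respond (H , cH) j eq | inj₂ ((U , Z) , refl , UZ , relG , s≡p , j≡t)
      with pos-≡ {U} {P} (trans (sym relG) rτ) s≡p
    ... | refl = respond-child Z UZ cH j j≡t

  similar-≼ : ∀ n → Claim n
  similar-≼ zero _ _ _ _ _ = tt
  similar-≼ (suc m) (_ , _ , c , rτ , p≢t , refl) (_ , _ , c' , rτ' , q≢t , refl) P∼Q (rev , na) (rev' , nb) =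
    Step.respond m (similar-≼ m) c rτ p≢t c' rτ' q≢t P∼Q rev na rev' nb

-- Theorem: n-reversible elements introduced at ∼_ID-equivalent positions are
-- ≃_n-similar in the chase.
mainTheorem4 : (σ : Signature) (Const : Set) (I0 : List (BaseFact σ Const))
    (Σu : List (UID σ)) →
    NonTrivialUIDs σ Σu → TransClosed σ Σu →
    (Keep : FId σ Const I0 → UID σ → Set) → ValidChoice σ Const I0 Σu Keep →
    (n : ℕ) (a b : Elem σ Const I0) (P Q : Pos σ) →
    IntroducedAt σ Const I0 Σu Keep a P →
    IntroducedAt σ Const I0 Σu Keep b Q →
    SimID σ Σu P Q →
    NReversible σ Const I0 Σu Keep n a →
    NReversible σ Const I0 Σu Keep n b →
    Sim σ n (ChaseInst σ Const I0 Σu Keep) a b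
mainTheorem4 σ Const I0 Σu nontrivial closed Keep _ n a b P Q ia ib P∼Q na nb =
  similar-≼ n ia ib P∼Q na nb , similar-≼ n ib ia (∼-sym P∼Q) nb na
  where open ChaseSimilarity σ Const I0 Σu nontrivial closed Keep
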